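{- Let $p$ be a prime and let $G$ be a connected $p$-periodic graph with $q$ edges. Then, modulo $p$, the Negami polynomial $N_G(u,x,y)$ is congruent to a polynomial of the form $\sum_{(i,j)} c_{i,j}\, u^{i}x^{q-jp}y^{jp}$ with integer coefficients $c_{i,j}$ (summing over finitely many pairs of nonnegative integers $(i,j)$); that is, every monomial of $N_G(u,x,y)$ whose coefficient is nonzero modulo $p$ has the form $u^i x^{q-jp}y^{jp}$ for some nonnegative integers $i,j$.
   Context: Graphs are finite 1-dimensional CW-complexes (loops and multiple edges are allowed). For an integer $p\ge 2$, a graph $G$ is called $p$-periodic if its automorphism group contains an element $h$ of order $p$ such that no edge of $G$ is mapped to itself by any nontrivial element of the cyclic group $\langle h\rangle\cong\mathbb{Z}_p$ (i.e. the induced action of $\mathbb{Z}_p$ on the edge set is fixed-point free). For a graph $G$ with edge set $E(G)$ and $q$ edges, the Negami polynomial is $N_G(u,x,y)=\sum_{Y\subseteq E(G)} u^{w(G-Y)}x^{q-|Y|}y^{|Y|}$, where $w(G-Y)$ denotes the number of connected components of the graph $G-Y$ obtained from $G$ by removing the edges in $Y$ (keeping all vertices). -}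

module Defs where

open import Data.Bool using (Bool; true; false; _∧_; _∨_; not; if_then_else_)
open import Data.Nat using (ℕ; zero; suc; _<_; _<ᵇ_)
import Data.Nat as ℕ
open import Data.Fin using (Fin; toℕ)
open import Data.Fin.Properties using (_≟_)
open import Data.Fin.Subset using (Subset; Side; inside; outside; ∣_∣)
open import Data.Vec using (Vec; []; _∷_; lookup)
open import Data.List using (List; []; _∷_; map; _++_; allFin; filterᵇ; length)
open import Data.Bool.ListAction using (any)
open import Data.Product using (_×_; _,_; proj₁; proj₂; Σ)
open import Data.Sum using (_⊎_)
open import Relation.Binary.PropositionalEquality using (_≡_)
open import Relation.Nullary using (¬_; does)

-- Finite graphs (loops and multiple edges allowed):
-- n vertices Fin n, q edges Fin q, each edge has two (possibly equal)
-- endpoints.  The orientation of the pair is irrelevant (see Auto).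

record Graph : Set where
  constructor mkGraph
  field
    nV   : ℕ
    nE   : ℕ
    ends : Fin nE → Fin nV × Fin nV
open Graph public

data Walk (G : Graph) : Fin (nV G) → Fin (nV G) → Set where
  here : ∀ {v} → Walk G v v
  step : ∀ {u w} (e : Fin (nE G)) →
         (ends G e ≡ (u , w)) ⊎ (ends G e ≡ (w , u)) →
         ∀ {v} → Walk G w v → Walk G u v

Connected : Graph → Set
Connected G = Σ (Fin (nV G)) (λ _ → ∀ u v → Walk G u v)

iter : ∀ {A : Set} → ℕ → (A → A) → A → A
iter zero    f x = x
iter (suc k) f x = f (iter k f x)

record Auto (G : Graph) : Set where
  constructor mkAuto
  field
    σ : Fin (nV G) → Fin (nV G)
    τ : Fin (nE G) → Fin (nE G)
    σ-inv : Σ (Fin (nV G) → Fin (nV G)) λ σ' →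
              (∀ v → σ (σ' v) ≡ v) × (∀ v → σ' (σ v) ≡ v)
    τ-inv : Σ (Fin (nE G) → Fin (nE G)) λ τ' →
              (∀ e → τ (τ' e) ≡ e) × (∀ e → τ' (τ e) ≡ e)
    incid : ∀ e → (ends G (τ e) ≡ (σ (proj₁ (ends G e)) , σ (proj₂ (ends G e))))
                ⊎ (ends G (τ e) ≡ (σ (proj₂ (ends G e)) , σ (proj₁ (ends G e))))
open Auto public

PowIsId : ∀ {G} → Auto G → ℕ → Set
PowIsId {G} h k = (∀ v → iter k (σ h) v ≡ v) × (∀ e → iter k (τ h) e ≡ e)

HasOrder : ∀ {G} → Auto G → ℕ → Set
HasOrder h p = PowIsId h p × (∀ k → 0 < k → k < p → ¬ PowIsId h k)

Periodic : ℕ → Graph → Set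
Periodic p G = Σ (Auto G) λ h →
  HasOrder h p × (∀ k → 0 < k → k < p → ∀ e → ¬ (iter k (τ h) e ≡ e))

inY : ∀ {q} → Subset q → Fin q → Bool
inY Y e with lookup Y e
... | inside  = true
... | outside = false

_==_ : ∀ {n} → Fin n → Fin n → Bool
a == b = does (a ≟ b)

-- reach G Y k u v : v is reachable from u in G - Y by a walk of length ≤ k
reach : (G : Graph) → Subset (nE G) → ℕ → Fin (nV G) → Fin (nV G) → Bool
reach G Y zero    u v = u == v
reach G Y (suc k) u v = reach G Y k u v ∨ any edgeOK (allFin (nE G))
  where
  edgeOK : Fin (nE G) → Bool
  edgeOK e = not (inY Y e) ∧
    ((reach G Y k u (proj₁ (ends G e)) ∧ (proj₂ (ends G e) == v)) ∨
     (reach G Y k u (proj₂ (ends G e)) ∧ (proj₁ (ends G e) == v)))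

-- same component in G - Y (a walk can be shortened to length < nV)
sameComp : (G : Graph) → Subset (nE G) → Fin (nV G) → Fin (nV G) → Bool
sameComp G Y u v = reach G Y (nV G) u v

-- w(G - Y): number of vertices that are the least vertex of their component
components : (G : Graph) → Subset (nE G) → ℕ
components G Y = length (filterᵇ isLeast (allFin (nV G)))
  where
  isLeast : Fin (nV G) → Bool
  isLeast v = not (any (λ u → (toℕ u <ᵇ toℕ v) ∧ sameComp G Y u v) (allFin (nV G)))

-- Negami polynomial N_G(u,x,y) = Σ_{Y ⊆ E} u^{w(G-Y)} x^{q-|Y|} y^{|Y|}.
-- Its coefficient of u^i x^{q-k} y^k (0 ≤ k ≤ q) is the number of edge
-- subsets Y with |Y| = k and w(G - Y) = i.

allSubsets : ∀ q → List (Subset q)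
allSubsets zero    = [] ∷ []
allSubsets (suc q) = map (inside ∷_) (allSubsets q) ++ map (outside ∷_) (allSubsets q)

negamiCoeff : Graph → ℕ → ℕ → ℕ
negamiCoeff G i k = length (filterᵇ
  (λ Y → (∣ Y ∣ ℕ.≡ᵇ k) ∧ (components G Y ℕ.≡ᵇ i))
  (allSubsets (nE G)))

module Submission where

-- The coefficient of u^i x^(q-k) y^k in N_G is the number of edge subsets Y with
-- |Y| = k and w(G - Y) = i.  An automorphism h of order p acts on edge subsets by
-- Y ↦ h⁻¹(Y), preserving |Y| and w(G - Y), so it permutes the subsets counted by
-- each coefficient.  Since p is prime, every orbit has size 1 or p; a subset fixed
-- by h is a union of ⟨h⟩-orbits of edges, each of size p because ⟨h⟩ acts freely
-- on edges, so its size is divisible by p.  Hence if p ∤ k the action on the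
-- counted subsets is free and p divides the coefficient.

open import Defs
open import Data.Bool using (Bool; true; false; T; not; _∧_; _∨_)
import Data.Bool.Properties as Bool
open import Data.Bool.Properties using (T?; T-≡; T-∧; T-∨)
open import Data.Bool.ListAction using (any)
open import Data.Fin using (Fin; zero; suc; toℕ; fromℕ<)
import Data.Fin.Properties as Fin
open import Data.Fin.Subset using (Subset; inside; outside; ∣_∣) renaming (_∈_ to _∈ₛ_)
open import Data.Fin.Subset.Properties using (p⊂q⇒∣p∣<∣q∣; x∈p⇒∣p-x∣<∣p∣; ∣p∣≤n)
import Data.List as List
open import Data.List using (List; []; _∷_; length; map; filter; filterᵇ; allFin; _++_)
open import Data.List.Membership.Propositional using (_∈_; _∉_; find; lose)
open import Data.List.Membership.Propositional.Properties
  using (∈-map⁺; ∈-map⁻; ∈-filter⁺; ∈-filter⁻; ∈-tabulate⁺; ∈-tabulate⁻; ∈-++⁺ˡ; ∈-++⁺ʳ; ∈-++⁻;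
         ∈-allFin)
open import Data.List.Membership.Propositional.Properties.WithK using (unique∧set⇒bag)
import Data.List.Membership.DecPropositional as DecMembership
open import Data.List.Properties using (length-map; length-++; length-tabulate)
open import Data.List.Relation.Binary.BagAndSetEquality using (∼bag⇒↭)
open import Data.List.Relation.Binary.Permutation.Propositional.Properties using (↭-length)
open import Data.List.Relation.Unary.Any using (here; there)
open import Data.List.Relation.Unary.Any.Properties using (any⁺; any⁻)
import Data.List.Relation.Unary.All as All
import Data.List.Relation.Unary.All.Properties as All
open import Data.List.Relation.Unary.Unique.Propositional using (Unique; []; _∷_)
import Data.List.Relation.Unary.Unique.Propositional.Properties as Unique
open import Data.Nat
  using (ℕ; zero; suc; _+_; _*_; _∸_; _<_; _≤_; _≤′_; ≤′-reflexive; ≤′-step; z≤n; s≤s; s≤s⁻¹;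
         _<ᵇ_; _≡ᵇ_; NonZero; >-nonZero⁻¹)
open import Data.Nat.Properties
  using (≤-refl; ≤-trans; ≤-<-trans; <-≤-trans; <-irrefl; <⇒≤; ≤⇒≤′; m∸n≤m; m+[n∸m]≡n;
         m<n⇒0<n∸m; m<n⇒m<1+n; +-monoˡ-≤; <ᵇ⇒<; <⇒<ᵇ; ≡ᵇ⇒≡)
open import Data.Nat.Coprimality using (coprime-Bézout; prime⇒coprime)
open import Data.Nat.Divisibility using (_∣_; _∣?_; ∣m∣n⇒∣m+n; ∣-refl; _∣0)
open import Data.Nat.GCD using (module Bézout)
open import Data.Nat.Primality using (Prime; prime⇒nonZero)
open import Data.Product using (_×_; _,_; proj₁; proj₂; ∃-syntax)
open import Data.Sum using (_⊎_; inj₁; inj₂; [_,_])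
open import Data.Unit using (tt)
open import Data.Vec using (Vec; []; _∷_; lookup; tabulate)
open import Data.Vec.Properties using ([]=↔lookup; lookup∘tabulate; tabulate∘lookup; ≡-dec)
open import Data.Vec.Relation.Binary.Pointwise.Extensional using (ext; Pointwise-≡⇒≡)
open import Function.Bundles using (_⇔_; mk⇔; Equivalence; Inverse)
open import Function.Definitions using (Injective)
import Function.Properties.Equivalence as ⇔
open import Relation.Binary.Definitions using (DecidableEquality; tri<; tri≈; tri>)
open import Relation.Binary.Structures using (IsEquivalence)
open import Relation.Binary.PropositionalEquality
  using (_≡_; _≢_; refl; sym; trans; cong; cong₂; subst; module ≡-Reasoning)
open import Relation.Nullary using (¬_; yes; no; contradiction)
open import Relation.Nullary.Decidable using (¬?; _×-dec_)

private variable A B : Set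

same-members⇒same-length : {xs ys : List A} → Unique xs → Unique ys →
  (∀ {z} → z ∈ xs ⇔ z ∈ ys) → length xs ≡ length ys
same-members⇒same-length uxs uys eq = ↭-length (∼bag⇒↭ (unique∧set⇒bag uxs uys eq))

map-unique : (φ : A → B) {xs : List A} → Unique xs →
  (∀ {x y} → x ∈ xs → y ∈ xs → φ x ≡ φ y → x ≡ y) → Unique (map φ xs)
map-unique φ []         inj = []
map-unique φ (x∉ ∷ uxs) inj =
  All.map⁺ (All.tabulate λ y∈ φx≡φy → All.lookup x∉ y∈ (inj (here refl) (there y∈) φx≡φy))
  ∷ map-unique φ uxs (λ x∈ y∈ → inj (there x∈) (there y∈))

bijection⇒same-length : {xs : List A} {ys : List B} → Unique xs → Unique ys →
  (φ : A → B) (ψ : B → A) →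
  (∀ {x} → x ∈ xs → φ x ∈ ys) → (∀ {y} → y ∈ ys → ψ y ∈ xs) →
  (∀ {x} → x ∈ xs → ψ (φ x) ≡ x) → (∀ {y} → y ∈ ys → φ (ψ y) ≡ y) →
  length xs ≡ length ys
bijection⇒same-length {xs = xs} {ys} uxs uys φ ψ φ∈ ψ∈ ψφ φψ =
  trans (sym (length-map φ xs))
        (same-members⇒same-length (map-unique φ uxs injective) uys (mk⇔ image⊆ys ys⊆image))
  where
  injective : ∀ {x y} → x ∈ xs → y ∈ xs → φ x ≡ φ y → x ≡ y
  injective {x} {y} x∈ y∈ eq = trans (sym (ψφ x∈)) (trans (cong ψ eq) (ψφ y∈))
  image⊆ys : ∀ {z} → z ∈ map φ xs → z ∈ ys
  image⊆ys z∈ with ∈-map⁻ φ z∈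
  ... | x , x∈ , refl = φ∈ x∈
  ys⊆image : ∀ {y} → y ∈ ys → y ∈ map φ xs
  ys⊆image {y} y∈ = subst (_∈ map φ xs) (φψ y∈) (∈-map⁺ φ (ψ∈ y∈))

∈-filterᵇ⁺ : (P : A → Bool) {xs : List A} {x : A} → x ∈ xs → T (P x) → x ∈ filterᵇ P xs
∈-filterᵇ⁺ P = ∈-filter⁺ (λ x → T? (P x))

∈-filterᵇ⁻ : (P : A → Bool) (xs : List A) {x : A} → x ∈ filterᵇ P xs → x ∈ xs × T (P x)
∈-filterᵇ⁻ P xs = ∈-filter⁻ (λ x → T? (P x)) {xs = xs}

filterᵇ-unique : (P : A → Bool) {xs : List A} → Unique xs → Unique (filterᵇ P xs)
filterᵇ-unique P = Unique.filter⁺ (λ x → T? (P x))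

filter-bijection : {xs : List A} {ys : List B} → Unique xs → Unique ys →
  (∀ x → x ∈ xs) → (∀ y → y ∈ ys) →
  (P : A → Bool) (Q : B → Bool) (φ : A → B) (ψ : B → A) →
  (∀ {x} → T (P x) → T (Q (φ x))) → (∀ {y} → T (Q y) → T (P (ψ y))) →
  (∀ {x} → T (P x) → ψ (φ x) ≡ x) → (∀ {y} → T (Q y) → φ (ψ y) ≡ y) →
  length (filterᵇ P xs) ≡ length (filterᵇ Q ys)
filter-bijection {xs = xs} {ys} uxs uys all-xs all-ys P Q φ ψ PQ QP ψφ φψ =
  bijection⇒same-length (filterᵇ-unique P uxs) (filterᵇ-unique Q uys) φ ψ
    (λ x∈ → ∈-filterᵇ⁺ Q (all-ys _) (PQ (proj₂ (∈-filterᵇ⁻ P xs x∈))))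
    (λ y∈ → ∈-filterᵇ⁺ P (all-xs _) (QP (proj₂ (∈-filterᵇ⁻ Q ys y∈))))
    (λ x∈ → ψφ (proj₂ (∈-filterᵇ⁻ P xs x∈)))
    (λ y∈ → φψ (proj₂ (∈-filterᵇ⁻ Q ys y∈)))

module Removal (_≟_ : DecidableEquality A) where
  open DecMembership _≟_ using (_∈?_)

  _─_ : List A → List A → List A
  xs ─ ys = filter (λ z → ¬? (z ∈? ys)) xs

  ∈-─⁺ : ∀ {xs ys z} → z ∈ xs → z ∉ ys → z ∈ xs ─ ys
  ∈-─⁺ {ys = ys} = ∈-filter⁺ (λ z → ¬? (z ∈? ys))

  ∈-─⁻ : ∀ xs ys {z} → z ∈ xs ─ ys → z ∈ xs × z ∉ ys
  ∈-─⁻ xs ys = ∈-filter⁻ (λ z → ¬? (z ∈? ys)) {xs = xs}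

  ─-unique : ∀ {xs} ys → Unique xs → Unique (xs ─ ys)
  ─-unique ys = Unique.filter⁺ (λ z → ¬? (z ∈? ys))

  length-─ : {xs ys : List A} → Unique xs → Unique ys → (∀ {z} → z ∈ ys → z ∈ xs) →
    length xs ≡ length ys + length (xs ─ ys)
  length-─ {xs} {ys} uxs uys ys⊆xs =
    trans (same-members⇒same-length uxs (Unique.++⁺ uys (─-unique ys uxs) disjoint)
                                     (mk⇔ split merge))
          (length-++ ys)
    where
    disjoint : ∀ {z} → ¬ (z ∈ ys × z ∈ xs ─ ys)
    disjoint (z∈ys , z∈rest) = proj₂ (∈-─⁻ xs ys z∈rest) z∈ys
    split : ∀ {z} → z ∈ xs → z ∈ ys ++ xs ─ ys
    split {z} z∈xs with z ∈? ys
    ... | yes z∈ys = ∈-++⁺ˡ z∈ys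
    ... | no  z∉ys = ∈-++⁺ʳ ys (∈-─⁺ z∈xs z∉ys)
    merge : ∀ {z} → z ∈ ys ++ xs ─ ys → z ∈ xs
    merge z∈ with ∈-++⁻ ys z∈
    ... | inj₁ z∈ys   = ys⊆xs z∈ys
    ... | inj₂ z∈rest = proj₁ (∈-─⁻ xs ys z∈rest)

iter-+ : (f : A → A) (a b : ℕ) (x : A) → iter (a + b) f x ≡ iter a f (iter b f x)
iter-+ f zero    b x = refl
iter-+ f (suc a) b x = cong f (iter-+ f a b x)

iter-commute : (f : A → A) (a : ℕ) (x : A) → iter a f (f x) ≡ f (iter a f x)
iter-commute f zero    x = refl
iter-commute f (suc a) x = cong f (iter-commute f a x)

iter-* : (f : A → A) (m : ℕ) {d : ℕ} {x : A} → iter d f x ≡ x → iter (m * d) f x ≡ x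
iter-* f zero    fd = refl
iter-* f (suc m) {d} {x} fd = begin
  iter (d + m * d) f x        ≡⟨ iter-+ f d (m * d) x ⟩
  iter d f (iter (m * d) f x) ≡⟨ cong (iter d f) (iter-* f m fd) ⟩
  iter d f x                  ≡⟨ fd ⟩
  x                           ∎
  where open ≡-Reasoning

iter-injective : (f : A → A) → Injective _≡_ _≡_ f → ∀ a → Injective _≡_ _≡_ (iter a f)
iter-injective f f-inj zero    eq = eq
iter-injective f f-inj (suc a) eq = iter-injective f f-inj a (f-inj eq)

-- If x returns after d steps and after p steps, p prime and 0 < d < p, then x is a
-- fixed point: by Bézout, 1 is an integer combination of d and p.
prime-period⇒fixed : (f : A → A) {p d : ℕ} {x : A} → Prime p → 0 < d → d < p →
  iter d f x ≡ x → iter p f x ≡ x → f x ≡ x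
prime-period⇒fixed f {p} {d} {x} p-prime (s≤s z≤n) d<p fd fp
  with coprime-Bézout (prime⇒coprime p-prime d<p)
... | Bézout.+- a b eq = begin
  f x                  ≡⟨ cong f (sym (iter-* f b fd)) ⟩
  iter (1 + b * d) f x ≡⟨ cong (λ m → iter m f x) eq ⟩
  iter (a * p) f x     ≡⟨ iter-* f a fp ⟩
  x                    ∎
  where open ≡-Reasoning
... | Bézout.-+ a b eq = begin
  f x                  ≡⟨ cong f (sym (iter-* f a fp)) ⟩
  iter (1 + a * p) f x ≡⟨ cong (λ m → iter m f x) eq ⟩
  iter (b * d) f x     ≡⟨ iter-* f b fd ⟩
  x                    ∎
  where open ≡-Reasoning

module FreeOrbits (_≟_ : DecidableEquality A) (f : A → A) (f-injective : Injective _≡_ _≡_ f)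
  (p : ℕ) .{{_ : NonZero p}} (periodic : ∀ x → iter p f x ≡ x) where

  open Removal _≟_

  Free : A → Set
  Free x = ∀ k → 0 < k → k < p → iter k f x ≢ x

  orbit : A → List A
  orbit x = List.tabulate (λ (j : Fin p) → iter (toℕ j) f x)

  iter-∈-orbit : ∀ {m} x → m < p → iter m f x ∈ orbit x
  iter-∈-orbit x m<p = subst (λ k → iter k f x ∈ orbit x) (Fin.toℕ-fromℕ< m<p)
                              (∈-tabulate⁺ (fromℕ< m<p))

  free⇒distinct : ∀ {x} → Free x → ∀ {i j} → i < j → j < p → iter i f x ≢ iter j f x
  free⇒distinct {x} free {i} {j} i<j j<p eq =
    free (j ∸ i) (m<n⇒0<n∸m i<j) (≤-<-trans (m∸n≤m j i) j<p)
      (sym (iter-injective f f-injective i (begin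
        iter i f x                  ≡⟨ eq ⟩
        iter j f x                  ≡⟨ cong (λ m → iter m f x) (sym (m+[n∸m]≡n (<⇒≤ i<j))) ⟩
        iter (i + (j ∸ i)) f x      ≡⟨ iter-+ f i (j ∸ i) x ⟩
        iter i f (iter (j ∸ i) f x) ∎)))
    where open ≡-Reasoning

  orbit-unique : ∀ {x} → Free x → Unique (orbit x)
  orbit-unique free = Unique.tabulate⁺ injective
    where
    injective : ∀ {i j} → iter (toℕ i) f _ ≡ iter (toℕ j) f _ → i ≡ j
    injective {i} {j} eq with Fin.<-cmp i j
    ... | tri< i<j _ _ = contradiction eq (free⇒distinct free i<j (Fin.toℕ<n j))
    ... | tri≈ _ i≡j _ = i≡j
    ... | tri> _ _ j<i = contradiction (sym eq) (free⇒distinct free j<i (Fin.toℕ<n i))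

  -- The complement of an orbit is closed under f.  (If f z = x, then z = f^(p-1) x
  -- because f^p x = x.)
  ∉-orbit-step : ∀ {x z} → z ∉ orbit x → f z ∉ orbit x
  ∉-orbit-step {x} {z} z∉ fz∈ with ∈-tabulate⁻ fz∈
  ... | Fin.zero  , fz≡x  =
    z∉ (subst (_∈ orbit x) (sym (f-injective (trans fz≡x (sym (periodic x)))))
              (iter-∈-orbit x ≤-refl))
  ... | Fin.suc j , fz≡fj = z∉ (subst (_∈ orbit x) (sym (f-injective fz≡fj))
                                     (iter-∈-orbit x (m<n⇒m<1+n (Fin.toℕ<n j))))

  Closed : List A → Set
  Closed L = ∀ {x} → x ∈ L → f x ∈ L

  iter-∈ : ∀ {L} → Closed L → ∀ m {x} → x ∈ L → iter m f x ∈ L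
  iter-∈ closed zero    x∈ = x∈
  iter-∈ closed (suc m) x∈ = closed (iter-∈ closed m x∈)

  -- Split off the orbit of the first element and recurse on the rest, which is again
  -- closed and free; the recursion is on an upper bound n of the length.
  free-orbits-divide : (L : List A) → Unique L → Closed L → (∀ {x} → x ∈ L → Free x) →
    p ∣ length L
  free-orbits-divide L = divide (length L) L ≤-refl
    where
    divide : ∀ n (L : List A) → length L ≤ n → Unique L → Closed L →
      (∀ {x} → x ∈ L → Free x) → p ∣ length L
    divide n       []          _    _  _      _    = p ∣0
    divide (suc n) L@(x ∷ _)  len≤ uL closed free =
      subst (p ∣_) (sym length≡) (∣m∣n⇒∣m+n ∣-refl
        (divide n rest rest≤ (─-unique (orbit x) uL) rest-closed rest-free))
      where
      rest : List A
      rest = L ─ orbit x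
      orbit⊆L : ∀ {z} → z ∈ orbit x → z ∈ L
      orbit⊆L z∈ with ∈-tabulate⁻ z∈
      ... | j , refl = iter-∈ closed (toℕ j) (here refl)
      rest-closed : Closed rest
      rest-closed z∈ with ∈-─⁻ L (orbit x) z∈
      ... | z∈L , z∉O = ∈-─⁺ (closed z∈L) (∉-orbit-step z∉O)
      rest-free : ∀ {z} → z ∈ rest → Free z
      rest-free z∈ = free (proj₁ (∈-─⁻ L (orbit x) z∈))
      length≡ : length L ≡ p + length rest
      length≡ = trans (length-─ uL (orbit-unique (free (here refl))) orbit⊆L)
                      (cong (_+ length rest) (length-tabulate _))
      rest≤ : length rest ≤ n
      rest≤ = s≤s⁻¹ (≤-trans (+-monoˡ-≤ (length rest) (>-nonZero⁻¹ p))
                             (subst (_≤ suc n) length≡ len≤))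

allSubsets-complete : ∀ q (Y : Subset q) → Y ∈ allSubsets q
allSubsets-complete zero    []            = here refl
allSubsets-complete (suc q) (inside  ∷ Y) = ∈-++⁺ˡ (∈-map⁺ (inside ∷_) (allSubsets-complete q Y))
allSubsets-complete (suc q) (outside ∷ Y) =
  ∈-++⁺ʳ (map (inside ∷_) (allSubsets q)) (∈-map⁺ (outside ∷_) (allSubsets-complete q Y))

allSubsets-unique : ∀ q → Unique (allSubsets q)
allSubsets-unique zero    = All.[] ∷ []
allSubsets-unique (suc q) =
  Unique.++⁺ (Unique.map⁺ ∷-injectiveʳ (allSubsets-unique q))
             (Unique.map⁺ ∷-injectiveʳ (allSubsets-unique q)) heads-differ
  where
  ∷-injectiveʳ : ∀ {b} {Y Z : Subset q} → b ∷ Y ≡ b ∷ Z → Y ≡ Z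
  ∷-injectiveʳ refl = refl
  heads-differ : ∀ {Y} →
    ¬ (Y ∈ map (inside ∷_) (allSubsets q) × Y ∈ map (outside ∷_) (allSubsets q))
  heads-differ (Y∈ , Y∈′) with ∈-map⁻ (inside ∷_) Y∈ | ∈-map⁻ (outside ∷_) Y∈′
  ... | _ , _ , refl | _ , _ , ()

lookup-ext : ∀ {A : Set} {n} {xs ys : Vec A n} → (∀ i → lookup xs i ≡ lookup ys i) → xs ≡ ys
lookup-ext eq = Pointwise-≡⇒≡ (ext eq)

∣tabulate∣ : ∀ {A : Set} {n} (P : A → Bool) (g : Fin n → A) →
  ∣ tabulate (λ i → P (g i)) ∣ ≡ length (filterᵇ P (List.tabulate g))
∣tabulate∣ {n = zero}  P g = refl
∣tabulate∣ {n = suc n} P g with P (g zero)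
... | true  = cong suc (∣tabulate∣ P (λ i → g (suc i)))
... | false = ∣tabulate∣ P (λ i → g (suc i))

size≡count : ∀ {n} (Y : Subset n) → ∣ Y ∣ ≡ length (filterᵇ (lookup Y) (allFin n))
size≡count Y = trans (cong ∣_∣ (sym (tabulate∘lookup Y))) (∣tabulate∣ (lookup Y) (λ e → e))

inY≡lookup : ∀ {q} (Y : Subset q) e → inY Y e ≡ lookup Y e
inY≡lookup Y e with lookup Y e
... | inside  = refl
... | outside = refl

_⊆ᵇ_ : ∀ {n} → (Fin n → Bool) → (Fin n → Bool) → Set
S ⊆ᵇ S′ = ∀ x → T (S x) → T (S′ x)

∈ₛ-tabulate⁺ : ∀ {n} (S : Fin n → Bool) {x} → T (S x) → x ∈ₛ tabulate S
∈ₛ-tabulate⁺ S {x} Sx =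
  Inverse.from []=↔lookup (trans (lookup∘tabulate S x) (Equivalence.to T-≡ Sx))

∈ₛ-tabulate⁻ : ∀ {n} (S : Fin n → Bool) {x} → x ∈ₛ tabulate S → T (S x)
∈ₛ-tabulate⁻ S {x} x∈ =
  Equivalence.from T-≡ (trans (sym (lookup∘tabulate S x)) (Inverse.to []=↔lookup x∈))

strict-growth : ∀ {n} {S S′ : Fin n → Bool} {x} → S ⊆ᵇ S′ → T (S′ x) → ¬ T (S x) →
  ∣ tabulate S ∣ < ∣ tabulate S′ ∣
strict-growth {S = S} {S′} {x} S⊆S′ S′x ¬Sx = p⊂q⇒∣p∣<∣q∣
  ( (λ {y} y∈ → ∈ₛ-tabulate⁺ S′ (S⊆S′ y (∈ₛ-tabulate⁻ S y∈)))
  , x , ∈ₛ-tabulate⁺ S′ S′x , (λ x∈ → ¬Sx (∈ₛ-tabulate⁻ S x∈)))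

T-== : ∀ {n} (a b : Fin n) → T (a == b) ⇔ a ≡ b
T-== a b with a Fin.≟ b
... | yes a≡b = mk⇔ (λ _ → a≡b) (λ _ → tt)
... | no  a≢b = mk⇔ (λ ()) a≢b

Link : ∀ {n} → (Fin n → Bool) → Fin n → Fin n × Fin n → Set
Link S v ab = (T (S (proj₁ ab)) × proj₂ ab ≡ v) ⊎ (T (S (proj₂ ab)) × proj₁ ab ≡ v)

linkᵇ : ∀ {n} → (Fin n → Bool) → Fin n → Fin n × Fin n → Bool
linkᵇ S v ab = (S (proj₁ ab) ∧ (proj₂ ab == v)) ∨ (S (proj₂ ab) ∧ (proj₁ ab == v))

linkᵇ-spec : ∀ {n} (S : Fin n → Bool) v ab → T (linkᵇ S v ab) ⇔ Link S v ab
linkᵇ-spec S v (a , b) = mk⇔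
  (λ t → [ (λ l → inj₁ (pair (S a) b v l)) , (λ l → inj₂ (pair (S b) a v l)) ]
           (Equivalence.to T-∨ t))
  (λ { (inj₁ l) → Equivalence.from T-∨ (inj₁ (unpair (S a) b v l))
     ; (inj₂ l) → Equivalence.from T-∨ (inj₂ (unpair (S b) a v l)) })
  where
  pair : ∀ s (c w : Fin _) → T (s ∧ (c == w)) → T s × c ≡ w
  pair s c w t with Equivalence.to T-∧ t
  ... | Ts , eq = Ts , Equivalence.to (T-== c w) eq
  unpair : ∀ s (c w : Fin _) → T s × c ≡ w → T (s ∧ (c == w))
  unpair s c w (Ts , eq) = Equivalence.from T-∧ (Ts , Equivalence.from (T-== c w) eq)

module Reachability (G : Graph) (Y : Subset (nE G)) where

  Vertex : Set
  Vertex = Fin (nV G)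

  Open : Fin (nE G) → Set
  Open e = T (not (inY Y e))

  -- One search round: add every vertex joined to S by an edge of G - Y.
  -- By definition, reach G Y (suc k) u is Step (reach G Y k u).
  Step : (Vertex → Bool) → Vertex → Bool
  Step S v = S v ∨ any (λ e → not (inY Y e) ∧ linkᵇ S v (ends G e)) (allFin (nE G))

  R : ℕ → Vertex → Vertex → Bool
  R k u = reach G Y k u

  step-spec : ∀ S v → T (Step S v) ⇔ (T (S v) ⊎ ∃[ e ] Open e × Link S v (ends G e))
  step-spec S v = mk⇔
    (λ t → [ inj₁ , (λ a → inj₂ (found (find (any⁻ _ _ a)))) ] (Equivalence.to T-∨ t))
    (λ { (inj₁ Sv) → Equivalence.from T-∨ (inj₁ Sv)
       ; (inj₂ (e , o , l)) → Equivalence.from T-∨ (inj₂ (any⁺ _ (lose (∈-allFin e)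
           (Equivalence.from T-∧ (o , Equivalence.from (linkᵇ-spec S v (ends G e)) l))))) })
    where
    found : ∃[ e ] e ∈ allFin (nE G) × T (not (inY Y e) ∧ linkᵇ S v (ends G e)) →
            ∃[ e ] Open e × Link S v (ends G e)
    found (e , _ , t) with Equivalence.to T-∧ t
    ... | o , l = e , o , Equivalence.to (linkᵇ-spec S v (ends G e)) l

  step-mono : ∀ S S′ → S ⊆ᵇ S′ → Step S ⊆ᵇ Step S′
  step-mono S S′ S⊆S′ v t with Equivalence.to (step-spec S v) t
  ... | inj₁ Sv = Equivalence.from (step-spec S′ v) (inj₁ (S⊆S′ v Sv))
  ... | inj₂ (e , o , l) = Equivalence.from (step-spec S′ v) (inj₂ (e , o , widen l))
    where
    widen : ∀ {ab} → Link S v ab → Link S′ v ab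
    widen (inj₁ (s , eq)) = inj₁ (S⊆S′ _ s , eq)
    widen (inj₂ (s , eq)) = inj₂ (S⊆S′ _ s , eq)

  step-inflationary : ∀ S → S ⊆ᵇ Step S
  step-inflationary S v Sv = Equivalence.from (step-spec S v) (inj₁ Sv)

  R-≤ : ∀ {k m} u → k ≤ m → R k u ⊆ᵇ R m u
  R-≤ u k≤m = go (≤⇒≤′ k≤m)
    where
    go : ∀ {k m} → k ≤′ m → R k u ⊆ᵇ R m u
    go (≤′-reflexive refl) x r = r
    go (≤′-step {m} k≤′m)  x r = step-inflationary (R m u) x (go k≤′m x r)

  Saturated : (Vertex → Bool) → Set
  Saturated S = Step S ⊆ᵇ S

  -- Until the search saturates, every round adds a vertex; as there are only nV G
  -- vertices, the search from u has saturated after nV G rounds.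
  module _ (u : Vertex) where

    saturated-or-growing : ∀ j → Saturated (R j u) ⊎ j < ∣ tabulate (R j u) ∣
    saturated-or-growing zero = inj₂ (≤-trans (s≤s z≤n) (x∈p⇒∣p-x∣<∣p∣ u∈R₀))
      where
      u∈R₀ : u ∈ₛ tabulate (R zero u)
      u∈R₀ = ∈ₛ-tabulate⁺ (R zero u) (Equivalence.from (T-== u u) refl)
    saturated-or-growing (suc j) with saturated-or-growing j
    ... | inj₁ sat = inj₁ (step-mono (Step (R j u)) (R j u) sat)
    ... | inj₂ j<∣R∣ with Fin.any? (λ x → T? (Step (R j u) x) ×-dec ¬? (T? (R j u x)))
    ...   | yes (x , new , ¬old) =
      inj₂ (≤-trans (s≤s j<∣R∣) (strict-growth (step-inflationary (R j u)) new ¬old))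
    ...   | no ¬new = inj₁ (step-mono (Step (R j u)) (R j u) sat)
      where
      sat : Saturated (R j u)
      sat x st with T? (R j u x)
      ... | yes old = old
      ... | no ¬old = contradiction (x , st , ¬old) ¬new

    saturated : Saturated (R (nV G) u)
    saturated with saturated-or-growing (nV G)
    ... | inj₁ sat = sat
    ... | inj₂ n<∣R∣ = contradiction (≤-trans n<∣R∣ (∣p∣≤n (tabulate (R (nV G) u)))) (<-irrefl refl)

  SameComp : Vertex → Vertex → Set
  SameComp u v = T (sameComp G Y u v)

  R₀-spec : ∀ u v → T (R zero u v) ⇔ u ≡ v
  R₀-spec = T-==

  closure : ∀ {u w} → SameComp u w → ∀ k → R k w ⊆ᵇ R (nV G) u
  closure {u} {w} u~w zero x r = subst (SameComp u) (Equivalence.to (R₀-spec w x) r) u~w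
  closure {u} u~w (suc k) x r =
    saturated u x (step-mono (R k _) (R (nV G) u) (closure u~w k) x r)

  same-refl : ∀ u → SameComp u u
  same-refl u = R-≤ {m = nV G} u z≤n u (Equivalence.from (R₀-spec u u) refl)

  same-trans : ∀ {u v w} → SameComp u v → SameComp v w → SameComp u w
  same-trans {w = w} u~v v~w = closure u~v (nV G) w v~w

  edge-same : ∀ {x w} e → Open e → Link (R zero x) w (ends G e) → SameComp x w
  edge-same {x} {w} e o l = R-≤ {m = nV G} x (≤-trans (s≤s z≤n) (Fin.toℕ<n x)) w
    (Equivalence.from (step-spec (R zero x) w) (inj₂ (e , o , l)))

  reach-sym : ∀ k {u x} → T (R k u x) → SameComp x u
  reach-sym zero {u} {x} r =
    subst (λ y → SameComp y u) (Equivalence.to (R₀-spec u x) r) (same-refl u)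
  reach-sym (suc k) {u} {x} r with Equivalence.to (step-spec (R k u) x) r
  ... | inj₁ r′ = reach-sym k r′
  ... | inj₂ (e , o , inj₁ (r′ , b≡x)) = same-trans
    (edge-same e o (inj₂ (Equivalence.from (R₀-spec x _) (sym b≡x) , refl))) (reach-sym k r′)
  ... | inj₂ (e , o , inj₂ (r′ , a≡x)) = same-trans
    (edge-same e o (inj₁ (Equivalence.from (R₀-spec x _) (sym a≡x) , refl))) (reach-sym k r′)

  same-sym : ∀ {u v} → SameComp u v → SameComp v u
  same-sym = reach-sym (nV G)

  sameComp-isEquivalence : IsEquivalence SameComp
  sameComp-isEquivalence = record
    { refl = same-refl _ ; sym = same-sym ; trans = same-trans }

T-not⁻ : ∀ {b} → T (not b) → ¬ T b
T-not⁻ {false} _ ()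

¬T-not⁻ : ∀ {b} → ¬ T (not b) → T b
¬T-not⁻ {true}  _    = tt
¬T-not⁻ {false} ¬tt = contradiction tt ¬tt

isLeastᵇ : ∀ {n} → (Fin n → Fin n → Bool) → Fin n → Bool
isLeastᵇ {n} e v = not (any (λ u → (toℕ u <ᵇ toℕ v) ∧ e u v) (allFin n))

classes : ∀ {n} → (Fin n → Fin n → Bool) → ℕ
classes {n} e = length (filterᵇ (isLeastᵇ e) (allFin n))

module LeastElements {n} (e : Fin n → Fin n → Bool)
  (e-equivalence : IsEquivalence (λ u v → T (e u v))) where

  open IsEquivalence e-equivalence renaming (refl to e-refl; sym to e-sym; trans to e-trans)

  IsLeast : Fin n → Set
  IsLeast v = T (isLeastᵇ e v)

  least⇒ : ∀ {u v} → IsLeast v → toℕ u < toℕ v → ¬ T (e u v)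
  least⇒ {u} {v} least u<v euv = T-not⁻ least
    (any⁺ _ (lose (∈-allFin u) (Equivalence.from T-∧ (<⇒<ᵇ u<v , euv))))

  ¬least⇒ : ∀ {v} → ¬ IsLeast v → ∃[ u ] toℕ u < toℕ v × T (e u v)
  ¬least⇒ {v} ¬least with find (any⁻ _ (allFin n) (¬T-not⁻ ¬least))
  ... | u , _ , t with Equivalence.to T-∧ t
  ...   | u<ᵇv , euv = u , <ᵇ⇒< (toℕ u) (toℕ v) u<ᵇv , euv

  -- Every class has a least element: descend to smaller related elements while
  -- possible (recursion on a bound for toℕ v).
  least-in-class : ∀ v → ∃[ r ] T (e r v) × IsLeast r
  least-in-class v = descend (suc (toℕ v)) v ≤-refl
    where
    descend : ∀ m v → toℕ v < m → ∃[ r ] T (e r v) × IsLeast r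
    descend (suc m) v (s≤s v≤m) with T? (isLeastᵇ e v)
    ... | yes least = v , e-refl , least
    ... | no ¬least with ¬least⇒ ¬least
    ...   | u , u<v , euv with descend m u (<-≤-trans u<v v≤m)
    ...     | r , eru , least = r , e-trans eru euv , least

  rep : Fin n → Fin n
  rep v = proj₁ (least-in-class v)

  rep-related : ∀ v → T (e (rep v) v)
  rep-related v = proj₁ (proj₂ (least-in-class v))

  rep-least : ∀ v → IsLeast (rep v)
  rep-least v = proj₂ (proj₂ (least-in-class v))

  least-unique : ∀ {a b} → IsLeast a → IsLeast b → T (e a b) → a ≡ b
  least-unique {a} {b} la lb eab with Fin.<-cmp a b
  ... | tri< a<b _ _ = contradiction eab (least⇒ lb a<b)
  ... | tri≈ _ a≡b _ = a≡b
  ... | tri> _ _ b<a = contradiction (e-sym eab) (least⇒ la b<a)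

  rep-of : ∀ {x v} → IsLeast v → T (e x v) → rep x ≡ v
  rep-of {x} lv exv = least-unique (rep-least x) lv (e-trans (rep-related x) exv)

-- Relabelling the points by a permutation σ does not change the number of classes:
-- x ↦ least element of the e-class of σ x is a bijection between least elements.
classes-invariant : ∀ {n} (e e′ : Fin n → Fin n → Bool) →
  IsEquivalence (λ u v → T (e u v)) →
  (σ σ⁻¹ : Fin n → Fin n) → (∀ v → σ (σ⁻¹ v) ≡ v) → (∀ v → σ⁻¹ (σ v) ≡ v) →
  (∀ u v → T (e′ u v) ⇔ T (e (σ u) (σ v))) →
  classes e′ ≡ classes e
classes-invariant {n} e e′ e-equivalence σ σ⁻¹ σσ⁻¹ σ⁻¹σ e′⇔e =
  filter-bijection (Unique.allFin⁺ n) (Unique.allFin⁺ n) ∈-allFin ∈-allFin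
    (isLeastᵇ e′) (isLeastᵇ e) φ ψ
    (λ {x} _ → L.rep-least (σ x)) (λ {y} _ → L′.rep-least (σ⁻¹ y)) ψφ φψ
  where
  open IsEquivalence e-equivalence renaming (refl to e-refl; sym to e-sym; trans to e-trans)
  to : ∀ {u v} → T (e′ u v) → T (e (σ u) (σ v))
  to = Equivalence.to (e′⇔e _ _)
  from : ∀ {u v} → T (e (σ u) (σ v)) → T (e′ u v)
  from = Equivalence.from (e′⇔e _ _)

  e′-equivalence : IsEquivalence (λ u v → T (e′ u v))
  e′-equivalence = record
    { refl  = from e-refl
    ; sym   = λ e′uv → from (e-sym (to e′uv))
    ; trans = λ e′uv e′vw → from (e-trans (to e′uv) (to e′vw)) }

  module L  = LeastElements e  e-equivalence
  module L′ = LeastElements e′ e′-equivalence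

  φ ψ : Fin n → Fin n
  φ x = L.rep (σ x)
  ψ y = L′.rep (σ⁻¹ y)

  ψφ : ∀ {x} → L′.IsLeast x → ψ (φ x) ≡ x
  ψφ {x} lx = L′.rep-of lx (from (subst (λ z → T (e z (σ x))) (sym (σσ⁻¹ (φ x)))
                                       (L.rep-related (σ x))))

  φψ : ∀ {y} → L.IsLeast y → φ (ψ y) ≡ y
  φψ {y} ly = L.rep-of ly (subst (λ z → T (e (σ (ψ y)) z)) (σσ⁻¹ y)
                                 (to (L′.rep-related (σ⁻¹ y))))

module Action (G : Graph) (h : Auto G) where

  private
    σ⁻¹ : Fin (nV G) → Fin (nV G)
    σ⁻¹ = proj₁ (σ-inv h)
    σσ⁻¹ : ∀ v → σ h (σ⁻¹ v) ≡ v
    σσ⁻¹ = proj₁ (proj₂ (σ-inv h))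
    σ⁻¹σ : ∀ v → σ⁻¹ (σ h v) ≡ v
    σ⁻¹σ = proj₂ (proj₂ (σ-inv h))
    τ⁻¹ : Fin (nE G) → Fin (nE G)
    τ⁻¹ = proj₁ (τ-inv h)
    ττ⁻¹ : ∀ e → τ h (τ⁻¹ e) ≡ e
    ττ⁻¹ = proj₁ (proj₂ (τ-inv h))
    τ⁻¹τ : ∀ e → τ⁻¹ (τ h e) ≡ e
    τ⁻¹τ = proj₂ (proj₂ (τ-inv h))

  σ-injective : Injective _≡_ _≡_ (σ h)
  σ-injective {x} {y} eq = trans (sym (σ⁻¹σ x)) (trans (cong σ⁻¹ eq) (σ⁻¹σ y))

  τ-injective : Injective _≡_ _≡_ (τ h)
  τ-injective {x} {y} eq = trans (sym (τ⁻¹τ x)) (trans (cong τ⁻¹ eq) (τ⁻¹τ y))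

  -- e ∈ act Y iff τ e ∈ Y, i.e. act Y = h⁻¹(Y).
  act : Subset (nE G) → Subset (nE G)
  act Y = tabulate (λ e → lookup Y (τ h e))

  lookup-act : ∀ Y e → lookup (act Y) e ≡ lookup Y (τ h e)
  lookup-act Y = lookup∘tabulate _

  act-injective : Injective _≡_ _≡_ act
  act-injective {Y} {Z} eq = lookup-ext λ e → begin
    lookup Y e                ≡⟨ cong (lookup Y) (sym (ττ⁻¹ e)) ⟩
    lookup Y (τ h (τ⁻¹ e))    ≡⟨ sym (lookup-act Y (τ⁻¹ e)) ⟩
    lookup (act Y) (τ⁻¹ e)    ≡⟨ cong (λ W → lookup W (τ⁻¹ e)) eq ⟩
    lookup (act Z) (τ⁻¹ e)    ≡⟨ lookup-act Z (τ⁻¹ e) ⟩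
    lookup Z (τ h (τ⁻¹ e))    ≡⟨ cong (lookup Z) (ττ⁻¹ e) ⟩
    lookup Z e                ∎
    where open ≡-Reasoning

  lookup-iter-act : ∀ j Y e → lookup (iter j act Y) e ≡ lookup Y (iter j (τ h) e)
  lookup-iter-act zero    Y e = refl
  lookup-iter-act (suc j) Y e = begin
    lookup (act (iter j act Y)) e      ≡⟨ lookup-act (iter j act Y) e ⟩
    lookup (iter j act Y) (τ h e)      ≡⟨ lookup-iter-act j Y (τ h e) ⟩
    lookup Y (iter j (τ h) (τ h e))    ≡⟨ cong (lookup Y) (iter-commute (τ h) j e) ⟩
    lookup Y (τ h (iter j (τ h) e))    ∎
    where open ≡-Reasoning

  act-periodic : ∀ p → (∀ e → iter p (τ h) e ≡ e) → ∀ Y → iter p act Y ≡ Y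
  act-periodic p τ-periodic Y =
    lookup-ext λ e → trans (lookup-iter-act p Y e) (cong (lookup Y) (τ-periodic e))

  card-invariant : ∀ Y → ∣ act Y ∣ ≡ ∣ Y ∣
  card-invariant Y = begin
    ∣ act Y ∣                                         ≡⟨ size≡count (act Y) ⟩
    length (filterᵇ (lookup (act Y)) (allFin (nE G))) ≡⟨ τ-bijection ⟩
    length (filterᵇ (lookup Y) (allFin (nE G)))       ≡⟨ sym (size≡count Y) ⟩
    ∣ Y ∣                                             ∎
    where
    open ≡-Reasoning
    τ-bijection : length (filterᵇ (lookup (act Y)) (allFin (nE G)))
                ≡ length (filterᵇ (lookup Y) (allFin (nE G)))
    τ-bijection = filter-bijection (Unique.allFin⁺ _) (Unique.allFin⁺ _) ∈-allFin ∈-allFin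
      (lookup (act Y)) (lookup Y) (τ h) τ⁻¹
      (λ {e} t → subst T (lookup-act Y e) t)
      (λ {e} t → subst T (sym (trans (lookup-act Y (τ⁻¹ e)) (cong (lookup Y) (ττ⁻¹ e)))) t)
      (λ {e} _ → τ⁻¹τ e) (λ {e} _ → ττ⁻¹ e)

  module _ (Y : Subset (nE G)) where
    private
      module RA = Reachability G (act Y)
      module RY = Reachability G Y

    inY-act : ∀ e → inY (act Y) e ≡ inY Y (τ h e)
    inY-act e = trans (inY≡lookup (act Y) e) (trans (lookup-act Y e) (sym (inY≡lookup Y (τ h e))))

    relabel-link : ∀ {S S′} → (∀ x → T (S x) ⇔ T (S′ (σ h x))) → ∀ v a b →
      Link S v (a , b) ⇔ Link S′ (σ h v) (σ h a , σ h b)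
    relabel-link S⇔S′ v a b = mk⇔
      (λ { (inj₁ (s , eq)) → inj₁ (Equivalence.to (S⇔S′ a) s , cong (σ h) eq)
         ; (inj₂ (s , eq)) → inj₂ (Equivalence.to (S⇔S′ b) s , cong (σ h) eq) })
      (λ { (inj₁ (s , eq)) → inj₁ (Equivalence.from (S⇔S′ a) s , σ-injective eq)
         ; (inj₂ (s , eq)) → inj₂ (Equivalence.from (S⇔S′ b) s , σ-injective eq) })

    swap-link : ∀ {S : Fin (nV G) → Bool} {v} a b → Link S v (a , b) ⇔ Link S v (b , a)
    swap-link a b = mk⇔ swap swap
      where
      swap : ∀ {S v a b} → Link S v (a , b) → Link S v (b , a)
      swap (inj₁ l) = inj₂ l
      swap (inj₂ l) = inj₁ l

    link-transport : ∀ {S S′} → (∀ x → T (S x) ⇔ T (S′ (σ h x))) → ∀ v e →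
      Link S v (ends G e) ⇔ Link S′ (σ h v) (ends G (τ h e))
    link-transport {S} {S′} S⇔S′ v e with ends G (τ h e) | incid h e
    ... | _ | inj₁ refl = relabel-link {S} {S′} S⇔S′ v _ _
    ... | _ | inj₂ refl =
      ⇔.trans (relabel-link {S} {S′} S⇔S′ v _ _) (swap-link {S′} (σ h (proj₁ (ends G e))) _)

    -- One search round in G - h⁻¹(Y) corresponds to one in G - Y: an open edge e
    -- becomes the open edge τ e.
    step-transport : ∀ {S S′} → (∀ x → T (S x) ⇔ T (S′ (σ h x))) → ∀ v →
      T (RA.Step S v) ⇔ T (RY.Step S′ (σ h v))
    step-transport {S} {S′} S⇔S′ v = mk⇔ forward backward
      where
      forward : T (RA.Step S v) → T (RY.Step S′ (σ h v))
      forward t with Equivalence.to (RA.step-spec S v) t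
      ... | inj₁ Sv =
        Equivalence.from (RY.step-spec S′ (σ h v)) (inj₁ (Equivalence.to (S⇔S′ v) Sv))
      ... | inj₂ (e , o , l) = Equivalence.from (RY.step-spec S′ (σ h v))
        (inj₂ (τ h e , subst (λ b → T (not b)) (inY-act e) o ,
               Equivalence.to (link-transport {S} {S′} S⇔S′ v e) l))
      backward : T (RY.Step S′ (σ h v)) → T (RA.Step S v)
      backward t with Equivalence.to (RY.step-spec S′ (σ h v)) t
      ... | inj₁ S′v =
        Equivalence.from (RA.step-spec S v) (inj₁ (Equivalence.from (S⇔S′ v) S′v))
      ... | inj₂ (e′ , open-link)
        with subst (λ e → RY.Open e × Link S′ (σ h v) (ends G e)) (sym (ττ⁻¹ e′)) open-link
      ...   | o , l = Equivalence.from (RA.step-spec S v)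
        (inj₂ (τ⁻¹ e′ , subst (λ b → T (not b)) (sym (inY-act (τ⁻¹ e′))) o ,
               Equivalence.from (link-transport {S} {S′} S⇔S′ v (τ⁻¹ e′)) l))

    reach-invariant : ∀ k u v → T (reach G (act Y) k u v) ⇔ T (reach G Y k (σ h u) (σ h v))
    reach-invariant zero    u v = mk⇔
      (λ t → Equivalence.from (T-== _ _) (cong (σ h) (Equivalence.to (T-== u v) t)))
      (λ t → Equivalence.from (T-== u v) (σ-injective (Equivalence.to (T-== _ _) t)))
    reach-invariant (suc k) u =
      step-transport {reach G (act Y) k u} {reach G Y k (σ h u)} (reach-invariant k u)

    components-invariant : components G (act Y) ≡ components G Y
    components-invariant = classes-invariant (sameComp G Y) (sameComp G (act Y))
      RY.sameComp-isEquivalence (σ h) σ⁻¹ σσ⁻¹ σ⁻¹σ (reach-invariant (nV G))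

module Divisibility (G : Graph) (h : Auto G) (p : ℕ) (p-prime : Prime p)
  (τ-periodic : ∀ e → iter p (τ h) e ≡ e)
  (τ-free : ∀ k → 0 < k → k < p → ∀ e → ¬ (iter k (τ h) e ≡ e)) where

  open Action G h
  instance _ = prime⇒nonZero p-prime

  -- An edge subset fixed by h is a union of ⟨τ⟩-orbits, all of size p.
  fixed-subset-divisible : ∀ Y → act Y ≡ Y → p ∣ ∣ Y ∣
  fixed-subset-divisible Y fixed = subst (p ∣_) (sym (size≡count Y))
    (free-orbits-divide edges (filterᵇ-unique (lookup Y) (Unique.allFin⁺ _)) closed
      (λ {e} _ k 0<k k<p → τ-free k 0<k k<p e))
    where
    open FreeOrbits Fin._≟_ (τ h) τ-injective p τ-periodic
    edges : List (Fin (nE G))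
    edges = filterᵇ (lookup Y) (allFin (nE G))
    closed : Closed edges
    closed {e} e∈ = ∈-filterᵇ⁺ (lookup Y) (∈-allFin (τ h e))
      (subst T (trans (cong (λ W → lookup W e) (sym fixed)) (lookup-act Y e))
               (proj₂ (∈-filterᵇ⁻ (lookup Y) (allFin (nE G)) e∈)))

  -- If p ∤ k, then ⟨h⟩ acts freely on the edge subsets Y with |Y| = k and
  -- w(G - Y) = i, so their number is a multiple of p.
  coefficient-divisible : ∀ i k → ¬ p ∣ k → p ∣ negamiCoeff G i k
  coefficient-divisible i k p∤k =
    free-orbits-divide counted (filterᵇ-unique P (allSubsets-unique _)) closed free
    where
    open FreeOrbits (≡-dec Bool._≟_) act act-injective p (act-periodic p τ-periodic)
    P : Subset (nE G) → Bool
    P Y = (∣ Y ∣ ≡ᵇ k) ∧ (components G Y ≡ᵇ i)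
    counted : List (Subset (nE G))
    counted = filterᵇ P (allSubsets (nE G))
    P-invariant : ∀ Y → P (act Y) ≡ P Y
    P-invariant Y = cong₂ (λ a b → (a ≡ᵇ k) ∧ (b ≡ᵇ i)) (card-invariant Y) (components-invariant Y)
    closed : Closed counted
    closed {Y} Y∈ = ∈-filterᵇ⁺ P (allSubsets-complete _ (act Y))
      (subst T (sym (P-invariant Y)) (proj₂ (∈-filterᵇ⁻ P (allSubsets (nE G)) Y∈)))
    -- A subset returning to itself under h^d, 0 < d < p, is fixed by h, hence has
    -- size divisible by p, which is impossible for size k.
    free : ∀ {Y} → Y ∈ counted → Free Y
    free {Y} Y∈ d 0<d d<p returns =
      p∤k (subst (p ∣_) ∣Y∣≡k (fixed-subset-divisible Y
        (prime-period⇒fixed act p-prime 0<d d<p returns (act-periodic p τ-periodic Y))))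
      where
      ∣Y∣≡k : ∣ Y ∣ ≡ k
      ∣Y∣≡k = ≡ᵇ⇒≡ ∣ Y ∣ k
        (proj₁ (Equivalence.to T-∧ (proj₂ (∈-filterᵇ⁻ P (allSubsets (nE G)) Y∈))))

-- Theorem 1.1: a coefficient of N_G not divisible by p belongs to a monomial
-- u^i x^(q-k) y^k with p ∣ k.  (The argument does not use connectedness.)
theorem1p1 : (p : ℕ) → Prime p → (G : Graph) → Connected G → Periodic p G →
    ∀ i k → k ≤ nE G → ¬ (p ∣ negamiCoeff G i k) → p ∣ k
theorem1p1 p p-prime G _ (h , (h^p≡id , _) , τ-free) i k _ p∤coeff with p ∣? k
... | yes p∣k = p∣k
... | no  p∤k = contradiction (coefficient-divisible i k p∤k) p∤coeff
  where open Divisibility G h p p-prime (proj₂ h^p≡id) τ-free
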